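{- Let $q$ be a prime power and let $f:\mathbb{F}_q\to\mathbb{F}_q$ be differentially $d$-uniform. Then \[|\mathrm{Im}(f)|\geq \left\lceil\frac{q}{d+1}\right\rceil.\] Moreover, if \[|\mathrm{Im}(f)| = \left\lceil\frac{q}{d+1}\right\rceil = \frac{q+\varepsilon}{d+1}\] with $1\leq \varepsilon\leq d$, then \[\sum_{y\in \mathrm{Im}(f)}(\omega(y)-(d+1))^2 \leq (d+1)(\varepsilon-1)+1.\]
   Context: A map $f:\mathbb{F}_q\to\mathbb{F}_q$ is called (differentially) $d$-uniform if $d=\max_{a\neq 0,\, b\in\mathbb{F}_q}|\{x\in\mathbb{F}_q: f(x+a)-f(x)=b\}|$. $\mathrm{Im}(f)$ denotes the image set of $f$, and for $y\in\mathbb{F}_q$, $\omega(y)=|f^{ -1}(\{y\})|$ is the number of preimages of $y$ under $f$. -}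

module Defs where

open import Data.Nat using (ℕ; zero; suc; _+_; _*_; _^_; _/_; _≤_; _<_)
open import Data.Nat.Primality using (Prime)
open import Data.Fin using (Fin; _≟_)
open import Data.List using (List; length; filter; map; allFin)
open import Data.List.Relation.Unary.Any using (any?)
open import Data.Product using (Σ; _×_; ∃)
open import Relation.Binary.PropositionalEquality using (_≡_)
open import Relation.Nullary using (¬_; Dec)
open import Relation.Unary using (Decidable)
open import Algebra.Structures using (IsCommutativeRing)

IsPrimePower : ℕ → Set
IsPrimePower q = Σ ℕ λ p → Σ ℕ λ k → Prime p × 1 ≤ k × q ≡ p ^ k

-- A finite field of order q, presented on the carrier Fin q
-- (every field with q elements is isomorphic to one of these).
record FiniteField (q : ℕ) : Set where
  field
    _+F_ _*F_ : Fin q → Fin q → Fin q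
    -F_       : Fin q → Fin q
    0F 1F     : Fin q
    isCommutativeRing : IsCommutativeRing _≡_ _+F_ _*F_ -F_ 0F 1F
    0≢1     : ¬ (0F ≡ 1F)
    inverse : (x : Fin q) → ¬ (x ≡ 0F) → Σ (Fin q) λ y → (x *F y) ≡ 1F

  _-F_ : Fin q → Fin q → Fin q
  x -F y = x +F (-F y)

open FiniteField public

elems : (q : ℕ) → List (Fin q)
elems q = allFin q

δ : {q : ℕ} (F : FiniteField q) (f : Fin q → Fin q) (a b : Fin q) → ℕ
δ {q} F f a b = length (filter (λ x → (_-F_ F (f (_+F_ F x a)) (f x)) ≟ b) (elems q))

IsDUniform : {q : ℕ} (F : FiniteField q) (f : Fin q → Fin q) (d : ℕ) → Set
IsDUniform {q} F f d =
  ((a b : Fin q) → ¬ (a ≡ 0F F) → δ F f a b ≤ d)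
  × (Σ (Fin q) λ a → Σ (Fin q) λ b → ¬ (a ≡ 0F F) × δ F f a b ≡ d)

inImage? : {q : ℕ} (f : Fin q → Fin q) → Decidable (λ y → Data.List.Relation.Unary.Any.Any (λ x → f x ≡ y) (elems q))
inImage? {q} f y = any? (λ x → f x ≟ y) (elems q)

image : {q : ℕ} (f : Fin q → Fin q) → List (Fin q)
image {q} f = filter (inImage? f) (elems q)

ω : {q : ℕ} (f : Fin q → Fin q) → Fin q → ℕ
ω {q} f y = length (filter (λ x → f x ≟ y) (elems q))

ceilDivSuc : ℕ → ℕ → ℕ
ceilDivSuc q d = (q + d) / suc d

-- Double counting. Σ ω(y) = q, and Σ ω(y)² counts the pairs (x, x') with f x = f x';
-- writing x' = x + a, these are Σ_a δ(a, 0) = q + Σ_{a ≠ 0} δ(a, 0) ≤ q + (q − 1) d.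
-- Expanding Σ_{y ∈ Im f} (ω(y) − (d + 1))² ≥ 0 with these two sums gives
-- |Im f| (d + 1)² ≥ q (d + 1) + d, which yields both the lower bound on |Im f| and,
-- when |Im f| (d + 1) = q + ε, the bound (d + 1)(ε − 1) + 1 on the sum of squares.
module Submission where

open import Defs
open import Data.Nat using (ℕ; zero; suc; _+_; _*_; _∸_; _≤_; ∣_-_∣; s≤s⁻¹)
open import Data.Nat.Properties hiding (_≟_)
open import Data.Nat.DivMod using (m<n*o⇒m/o<n)
open import Data.Nat.ListAction using (sum)
open import Data.Nat.Solver using (module +-*-Solver)
open import Data.Fin as Fin using (Fin; _≟_)
open import Data.Fin.Properties using (punchInᵢ≢i)
open import Data.Fin.Permutation using (Permutation′; permutation)
open import Data.Vec.Functional using (head; tail; removeAt)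
open import Data.List using ([]; _∷_; length; map; filter; tabulate; allFin)
open import Data.List.Properties using (map-tabulate)
open import Data.List.Relation.Unary.Any using (Any)
open import Data.List.Membership.Propositional using (lose)
open import Data.List.Membership.Propositional.Properties using (∈-allFin)
open import Data.Bool using (true; false; if_then_else_)
open import Data.Product using (_×_; _,_)
open import Data.Sum using (inj₁; inj₂)
open import Function using (_∘_; id; _⇔_; mk⇔)
open import Relation.Nullary using (Dec; does; ¬_; yes; no)
open import Relation.Nullary.Decidable using (dec-true; dec-false; does-⇔)
open import Relation.Unary using (Pred; Decidable)
open import Relation.Binary.PropositionalEquality
open import Algebra.Bundles using (CommutativeRing; Group)
open import Algebra.Properties.Semiring.Sum +-*-semiring
  using (sum-syntax; sum-cong-≗; sum-replicate-zero; sum-remove; ∑-comm; ∑-permute; *-distribʳ-sum)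
  renaming (sum to ∑)
import Algebra.Properties.Group as GroupProperties

𝟙 : ∀ {p} {P : Set p} → Dec P → ℕ
𝟙 P? = if does P? then 1 else 0

module _ {p} {P : Set p} (P? : Dec P) where

  𝟙-yes : P → 𝟙 P? ≡ 1
  𝟙-yes x = cong (λ b → if b then 1 else 0) (dec-true P? x)

  𝟙-no : ¬ P → 𝟙 P? ≡ 0
  𝟙-no ¬x = cong (λ b → if b then 1 else 0) (dec-false P? ¬x)

𝟙-⇔ : ∀ {p q} {P : Set p} {Q : Set q} → P ⇔ Q → (P? : Dec P) (Q? : Dec Q) → 𝟙 P? ≡ 𝟙 Q?
𝟙-⇔ P⇔Q P? Q? = cong (λ b → if b then 1 else 0) (does-⇔ P⇔Q P? Q?)

module _ {a p} {A : Set a} {P : Pred A p} (P? : Decidable P) where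

  length-filter≡sum-𝟙 : ∀ xs → length (filter P? xs) ≡ sum (map (𝟙 ∘ P?) xs)
  length-filter≡sum-𝟙 [] = refl
  length-filter≡sum-𝟙 (x ∷ xs) with does (P? x)
  ... | true  = cong suc (length-filter≡sum-𝟙 xs)
  ... | false = length-filter≡sum-𝟙 xs

  sum-map-filter : ∀ (g : A → ℕ) xs → sum (map g (filter P? xs)) ≡ sum (map (λ x → 𝟙 (P? x) * g x) xs)
  sum-map-filter g [] = refl
  sum-map-filter g (x ∷ xs) with does (P? x)
  ... | true  = cong₂ _+_ (sym (+-identityʳ (g x))) (sum-map-filter g xs)
  ... | false = sum-map-filter g xs

sum-tabulate : ∀ {n} (g : Fin n → ℕ) → sum (tabulate g) ≡ ∑ g
sum-tabulate {zero}  g = refl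
sum-tabulate {suc n} g = cong (head g +_) (sum-tabulate (tail g))

sum-map-allFin : ∀ {n} (g : Fin n → ℕ) → sum (map g (allFin n)) ≡ ∑ g
sum-map-allFin g = trans (cong sum (map-tabulate id g)) (sum-tabulate g)

length-filter-allFin : ∀ {n p} {P : Pred (Fin n) p} (P? : Decidable P) →
                       length (filter P? (allFin n)) ≡ ∑[ i < n ] 𝟙 (P? i)
length-filter-allFin P? = trans (length-filter≡sum-𝟙 P? (allFin _)) (sum-map-allFin (𝟙 ∘ P?))

∑-const : ∀ n c → ∑[ i < n ] c ≡ n * c
∑-const zero    c = refl
∑-const (suc n) c = cong (c +_) (∑-const n c)

∑-mono-≤ : ∀ {n} {g h : Fin n → ℕ} → (∀ i → g i ≤ h i) → ∑ g ≤ ∑ h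
∑-mono-≤ {zero}  g≤h = ≤-refl
∑-mono-≤ {suc n} g≤h = +-mono-≤ (g≤h Fin.zero) (∑-mono-≤ (g≤h ∘ Fin.suc))

∑-zero : ∀ {n} {g : Fin n → ℕ} → (∀ i → g i ≡ 0) → ∑ g ≡ 0
∑-zero {n} g≡0 = trans (sum-cong-≗ g≡0) (sum-replicate-zero n)

∑-sift : ∀ {n} (g : Fin n → ℕ) c → (∀ i → i ≢ c → g i ≡ 0) → ∑ g ≡ g c
∑-sift {suc n} g c g≡0 = begin
  ∑ g                     ≡⟨ sum-remove {i = c} g ⟩
  g c + ∑ (removeAt g c)  ≡⟨ cong (g c +_) (∑-zero (λ i → g≡0 _ (punchInᵢ≢i c i))) ⟩
  g c + 0                 ≡⟨ +-identityʳ (g c) ⟩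
  g c                     ∎
  where open ≡-Reasoning

∑-𝟙≟ : ∀ {n} c (g : Fin n → ℕ) → ∑[ i < n ] (𝟙 (c ≟ i) * g i) ≡ g c
∑-𝟙≟ c g = begin
  ∑[ i < _ ] (𝟙 (c ≟ i) * g i)  ≡⟨ ∑-sift _ c (λ i i≢c → cong (_* g i) (𝟙-no (c ≟ i) (i≢c ∘ sym))) ⟩
  𝟙 (c ≟ c) * g c               ≡⟨ cong (_* g c) (𝟙-yes (c ≟ c) refl) ⟩
  1 * g c                       ≡⟨ *-identityˡ (g c) ⟩
  g c                           ∎
  where open ≡-Reasoning

∑-≤-except : ∀ {n d} (t : Fin n → ℕ) c → (∀ i → i ≢ c → t i ≤ d) → ∑ t + d ≤ t c + n * d
∑-≤-except {suc n} {d} t c t≤d = begin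
  ∑ t + d                          ≡⟨ cong (_+ d) (sum-remove {i = c} t) ⟩
  t c + ∑ (removeAt t c) + d       ≤⟨ +-monoˡ-≤ d (+-monoʳ-≤ (t c) (∑-mono-≤ (λ i → t≤d _ (punchInᵢ≢i c i)))) ⟩
  t c + ∑[ i < n ] d + d           ≡⟨ cong (λ s → t c + s + d) (∑-const n d) ⟩
  t c + n * d + d                  ≡⟨ +-assoc (t c) (n * d) d ⟩
  t c + (n * d + d)                ≡⟨ cong (t c +_) (+-comm (n * d) d) ⟩
  t c + suc n * d                  ∎
  where open ≤-Reasoning

∣m-m+k∣²+2m[m+k] : ∀ m k → ∣ m - m + k ∣ * ∣ m - m + k ∣ + 2 * (m * (m + k)) ≡ m * m + (m + k) * (m + k)
∣m-m+k∣²+2m[m+k] m k rewrite ∣m-m+n∣≡n m k =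
  solve 2 (λ m k → k :* k :+ con 2 :* (m :* (m :+ k)) := m :* m :+ (m :+ k) :* (m :+ k)) refl m k
  where open +-*-Solver

∣m-n∣²+2mn-≤ : ∀ {m n} → m ≤ n → ∣ m - n ∣ * ∣ m - n ∣ + 2 * (m * n) ≡ m * m + n * n
∣m-n∣²+2mn-≤ {m} m≤n = subst (λ n → ∣ m - n ∣ * ∣ m - n ∣ + 2 * (m * n) ≡ m * m + n * n)
                             (m+[n∸m]≡n m≤n) (∣m-m+k∣²+2m[m+k] m (_ ∸ m))

∣m-n∣²+2mn : ∀ m n → ∣ m - n ∣ * ∣ m - n ∣ + 2 * (m * n) ≡ m * m + n * n
∣m-n∣²+2mn m n with ≤-total m n
... | inj₁ m≤n = ∣m-n∣²+2mn-≤ m≤n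
... | inj₂ n≤m = begin
  ∣ m - n ∣ * ∣ m - n ∣ + 2 * (m * n)  ≡⟨ cong₂ (λ u v → u * u + 2 * v) (∣-∣-comm m n) (*-comm m n) ⟩
  ∣ n - m ∣ * ∣ n - m ∣ + 2 * (n * m)  ≡⟨ ∣m-n∣²+2mn-≤ n≤m ⟩
  n * n + m * m                        ≡⟨ +-comm (n * n) (m * m) ⟩
  m * m + n * n                        ∎
  where open ≡-Reasoning

sum-square-deviation : ∀ {a} {A : Set a} c (g : A → ℕ) xs →
  sum (map (λ x → ∣ g x - c ∣ * ∣ g x - c ∣) xs) + 2 * (sum (map g xs) * c)
    ≡ sum (map (λ x → g x * g x) xs) + length xs * (c * c)
sum-square-deviation c g []       = refl
sum-square-deviation c g (x ∷ xs) = begin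
  ∣ g x - c ∣ * ∣ g x - c ∣ + D + 2 * ((g x + S) * c)
    ≡⟨ solve 5 (λ e D w S c → e :+ D :+ con 2 :* ((w :+ S) :* c) := (e :+ con 2 :* (w :* c)) :+ (D :+ con 2 :* (S :* c)))
             refl (∣ g x - c ∣ * ∣ g x - c ∣) D (g x) S c ⟩
  (∣ g x - c ∣ * ∣ g x - c ∣ + 2 * (g x * c)) + (D + 2 * (S * c))
    ≡⟨ cong₂ _+_ (∣m-n∣²+2mn (g x) c) (sum-square-deviation c g xs) ⟩
  (g x * g x + c * c) + (S₂ + length xs * (c * c))
    ≡⟨ solve 4 (λ w² c² S₂ n → (w² :+ c²) :+ (S₂ :+ n :* c²) := (w² :+ S₂) :+ (con 1 :+ n) :* c²)
             refl (g x * g x) (c * c) S₂ (length xs) ⟩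
  g x * g x + S₂ + suc (length xs) * (c * c)
    ∎
  where
  open ≡-Reasoning
  open +-*-Solver
  S = sum (map g xs)
  S₂ = sum (map (λ x → g x * g x) xs)
  D = sum (map (λ x → ∣ g x - c ∣ * ∣ g x - c ∣) xs)

module _ {q} (f : Fin q → Fin q) where

  ω≡∑𝟙 : ∀ y → ω f y ≡ ∑[ x < q ] 𝟙 (f x ≟ y)
  ω≡∑𝟙 y = length-filter-allFin (λ x → f x ≟ y)

  ∑-fibres : ∀ (g : Fin q → ℕ) → ∑[ y < q ] (ω f y * g y) ≡ ∑[ x < q ] g (f x)
  ∑-fibres g = begin
    ∑[ y < q ] (ω f y * g y)                     ≡⟨ sum-cong-≗ (λ y → cong (_* g y) (ω≡∑𝟙 y)) ⟩
    ∑[ y < q ] (∑[ x < q ] 𝟙 (f x ≟ y) * g y)    ≡⟨ sum-cong-≗ (λ y → *-distribʳ-sum (g y) (λ x → 𝟙 (f x ≟ y))) ⟩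
    ∑[ y < q ] ∑[ x < q ] (𝟙 (f x ≟ y) * g y)    ≡⟨ ∑-comm (λ x y → 𝟙 (f x ≟ y) * g y) ⟨
    ∑[ x < q ] ∑[ y < q ] (𝟙 (f x ≟ y) * g y)    ≡⟨ sum-cong-≗ (λ x → ∑-𝟙≟ (f x) g) ⟩
    ∑[ x < q ] g (f x)                           ∎
    where open ≡-Reasoning

  ∑-ω : ∑ (ω f) ≡ q
  ∑-ω = begin
    ∑ (ω f)                  ≡⟨ sum-cong-≗ (λ y → sym (*-identityʳ (ω f y))) ⟩
    ∑[ y < q ] (ω f y * 1)   ≡⟨ ∑-fibres (λ _ → 1) ⟩
    ∑[ x < q ] 1             ≡⟨ ∑-const q 1 ⟩
    q * 1                    ≡⟨ *-identityʳ q ⟩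
    q                        ∎
    where open ≡-Reasoning

  ω-off-image : ∀ y → ¬ Any (λ x → f x ≡ y) (allFin q) → ω f y ≡ 0
  ω-off-image y y∉Im = trans (ω≡∑𝟙 y) (∑-zero (λ x → 𝟙-no (f x ≟ y) (y∉Im ∘ lose (∈-allFin x))))

  sum-image : ∀ (g : Fin q → ℕ) → (∀ y → ω f y ≡ 0 → g y ≡ 0) → sum (map g (image f)) ≡ ∑ g
  sum-image g g≡0 = begin
    sum (map g (image f))                                 ≡⟨ sum-map-filter (inImage? f) g (allFin q) ⟩
    sum (map (λ y → 𝟙 (inImage? f y) * g y) (allFin q))   ≡⟨ sum-map-allFin (λ y → 𝟙 (inImage? f y) * g y) ⟩
    ∑[ y < q ] (𝟙 (inImage? f y) * g y)                   ≡⟨ sum-cong-≗ off-image-irrelevant ⟩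
    ∑ g                                                   ∎
    where
    open ≡-Reasoning
    off-image-irrelevant : ∀ y → 𝟙 (inImage? f y) * g y ≡ g y
    off-image-irrelevant y with inImage? f y
    ... | yes _    = +-identityʳ (g y)
    ... | no y∉Im  = sym (g≡0 y (ω-off-image y y∉Im))

  sum-image-square-deviation : ∀ c → sum (map (λ y → ∣ ω f y - c ∣ * ∣ ω f y - c ∣) (image f)) + 2 * (q * c)
                                       ≡ ∑[ y < q ] (ω f y * ω f y) + length (image f) * (c * c)
  sum-image-square-deviation c = begin
    A + 2 * (q * c)                                      ≡⟨ cong (λ s → A + 2 * (s * c)) ∑ω-over-image ⟨
    A + 2 * (sum (map (ω f) (image f)) * c)              ≡⟨ sum-square-deviation c (ω f) (image f) ⟩
    sum (map (λ y → ω f y * ω f y) (image f)) + I * (c * c)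
      ≡⟨ cong (_+ I * (c * c)) (sum-image (λ y → ω f y * ω f y) (λ _ ω≡0 → cong (λ w → w * w) ω≡0)) ⟩
    ∑[ y < q ] (ω f y * ω f y) + I * (c * c)             ∎
    where
    open ≡-Reasoning
    A = sum (map (λ y → ∣ ω f y - c ∣ * ∣ ω f y - c ∣) (image f))
    I = length (image f)
    ∑ω-over-image : sum (map (ω f) (image f)) ≡ q
    ∑ω-over-image = trans (sum-image (ω f) (λ _ → id)) ∑-ω

module _ {q} (F : FiniteField q) where

  private
    ring : CommutativeRing _ _
    ring = record { isCommutativeRing = isCommutativeRing F }
    open CommutativeRing ring using (+-group; 0#) renaming (_+_ to _⊕_; +-identityʳ to ⊕-identityʳ)
    open Group +-group using (_\\_)
    open GroupProperties +-group using (\\-leftDividesˡ; \\-leftDividesʳ; x∙y⁻¹≈ε⇒x≈y; x≈y⇒x∙y⁻¹≈ε)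

  translation : Fin q → Permutation′ q
  translation x = permutation (x ⊕_) (x \\_) (\\-leftDividesˡ x) (\\-leftDividesʳ x)

  module _ (f : Fin q → Fin q) where

    δ-at-0≡collisions : ∀ a → δ F f a 0# ≡ ∑[ x < q ] 𝟙 (f (x ⊕ a) ≟ f x)
    δ-at-0≡collisions a =
      trans (length-filter-allFin (λ x → _-F_ F (f (x ⊕ a)) (f x) ≟ 0#)) (sum-cong-≗ difference-vanishes⇔equal)
      where
      difference-vanishes⇔equal : ∀ x → 𝟙 (_-F_ F (f (x ⊕ a)) (f x) ≟ 0#) ≡ 𝟙 (f (x ⊕ a) ≟ f x)
      difference-vanishes⇔equal x = 𝟙-⇔ (mk⇔ (x∙y⁻¹≈ε⇒x≈y _ _) x≈y⇒x∙y⁻¹≈ε) (_ ≟ 0#) (f (x ⊕ a) ≟ f x)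

    δ-0-0 : δ F f 0# 0# ≡ q
    δ-0-0 = begin
      δ F f 0# 0#                         ≡⟨ δ-at-0≡collisions 0# ⟩
      ∑[ x < q ] 𝟙 (f (x ⊕ 0#) ≟ f x)     ≡⟨ sum-cong-≗ (λ x → 𝟙-yes (f (x ⊕ 0#) ≟ f x) (cong f (⊕-identityʳ x))) ⟩
      ∑[ x < q ] 1                        ≡⟨ ∑-const q 1 ⟩
      q * 1                               ≡⟨ *-identityʳ q ⟩
      q                                   ∎
      where open ≡-Reasoning

    ∑-ω²≡∑-δ : ∑[ y < q ] (ω f y * ω f y) ≡ ∑[ a < q ] δ F f a 0#
    ∑-ω²≡∑-δ = begin
      ∑[ y < q ] (ω f y * ω f y)                     ≡⟨ ∑-fibres f (ω f) ⟩
      ∑[ x < q ] ω f (f x)                           ≡⟨ sum-cong-≗ (λ x → trans (ω≡∑𝟙 f (f x)) (∑-permute _ (translation x))) ⟩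
      ∑[ x < q ] ∑[ a < q ] 𝟙 (f (x ⊕ a) ≟ f x)      ≡⟨ ∑-comm (λ x a → 𝟙 (f (x ⊕ a) ≟ f x)) ⟩
      ∑[ a < q ] ∑[ x < q ] 𝟙 (f (x ⊕ a) ≟ f x)      ≡⟨ sum-cong-≗ (sym ∘ δ-at-0≡collisions) ⟩
      ∑[ a < q ] δ F f a 0#                          ∎
      where open ≡-Reasoning

    ∑-ω²-bound : ∀ {d} → ((a b : Fin q) → ¬ (a ≡ 0#) → δ F f a b ≤ d) →
                 ∑[ y < q ] (ω f y * ω f y) + d ≤ q * suc d
    ∑-ω²-bound {d} uniform = begin
      ∑[ y < q ] (ω f y * ω f y) + d   ≡⟨ cong (_+ d) ∑-ω²≡∑-δ ⟩
      ∑[ a < q ] δ F f a 0# + d        ≤⟨ ∑-≤-except _ 0# (λ a a≢0 → uniform a 0# a≢0) ⟩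
      δ F f 0# 0# + q * d              ≡⟨ cong (_+ q * d) δ-0-0 ⟩
      q + q * d                        ≡⟨ *-suc q d ⟨
      q * suc d                        ∎
      where open ≤-Reasoning

ceilDivSuc-≤ : ∀ {q d n} → q ≤ n * suc d → ceilDivSuc q d ≤ n
ceilDivSuc-≤ {q} {d} {n} q≤n[d+1] = s≤s⁻¹ (m<n*o⇒m/o<n {q + d} {suc n} {suc d} (begin-strict
  q + d              <⟨ +-monoʳ-< q (n<1+n d) ⟩
  q + suc d          ≤⟨ +-monoˡ-≤ (suc d) q≤n[d+1] ⟩
  n * suc d + suc d  ≡⟨ +-comm (n * suc d) (suc d) ⟩
  suc n * suc d      ∎))
  where open ≤-Reasoning

module _ (A S I q d : ℕ)
         (expansion : A + 2 * (q * suc d) ≡ S + I * (suc d * suc d))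
         (S+d≤q[d+1] : S + d ≤ q * suc d) where

  private
    surplus : A + suc d * q + d ≤ suc d * (I * suc d)
    surplus = +-cancelʳ-≤ (suc d * q) _ _ (begin
      A + suc d * q + d + suc d * q     ≡⟨ solve 3 (λ A q d → A :+ (con 1 :+ d) :* q :+ d :+ (con 1 :+ d) :* q
                                                          := A :+ con 2 :* (q :* (con 1 :+ d)) :+ d) refl A q d ⟩
      A + 2 * (q * suc d) + d           ≡⟨ cong (_+ d) expansion ⟩
      S + I * (suc d * suc d) + d       ≡⟨ solve 3 (λ S I d → S :+ I :* ((con 1 :+ d) :* (con 1 :+ d)) :+ d
                                                          := S :+ d :+ (con 1 :+ d) :* (I :* (con 1 :+ d))) refl S I d ⟩
      S + d + suc d * (I * suc d)       ≤⟨ +-monoˡ-≤ _ S+d≤q[d+1] ⟩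
      q * suc d + suc d * (I * suc d)   ≡⟨ solve 3 (λ q I d → q :* (con 1 :+ d) :+ (con 1 :+ d) :* (I :* (con 1 :+ d))
                                                          := (con 1 :+ d) :* (I :* (con 1 :+ d)) :+ (con 1 :+ d) :* q) refl q I d ⟩
      suc d * (I * suc d) + suc d * q   ∎)
      where
      open ≤-Reasoning
      open +-*-Solver

  q≤I[d+1] : q ≤ I * suc d
  q≤I[d+1] = *-cancelˡ-≤ (suc d) (begin
    suc d * q              ≤⟨ m≤n+m (suc d * q) A ⟩
    A + suc d * q          ≤⟨ m≤m+n (A + suc d * q) d ⟩
    A + suc d * q + d      ≤⟨ surplus ⟩
    suc d * (I * suc d)    ∎)
    where open ≤-Reasoning

  deviation-bound : ∀ e → I * suc d ≡ q + suc e → A ≤ suc d * e + 1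
  deviation-bound e I[d+1]≡q+ε = +-cancelʳ-≤ (suc d * q + d) _ _ (begin
    A + (suc d * q + d)               ≡⟨ +-assoc A (suc d * q) d ⟨
    A + suc d * q + d                 ≤⟨ surplus ⟩
    suc d * (I * suc d)               ≡⟨ cong (suc d *_) I[d+1]≡q+ε ⟩
    suc d * (q + suc e)               ≡⟨ solve 3 (λ q d e → (con 1 :+ d) :* (q :+ (con 1 :+ e))
                                                  := (con 1 :+ d) :* e :+ con 1 :+ ((con 1 :+ d) :* q :+ d)) refl q d e ⟩
    suc d * e + 1 + (suc d * q + d)   ∎)
    where
    open ≤-Reasoning
    open +-*-Solver

theorem2p6 : (q : ℕ) → IsPrimePower q → (F : FiniteField q) → (f : Fin q → Fin q) → (d : ℕ) → IsDUniform F f d →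
  (ceilDivSuc q d ≤ length (image f))
  × ((ε : ℕ) → 1 ≤ ε → ε ≤ d → length (image f) ≡ ceilDivSuc q d → length (image f) * suc d ≡ q + ε →
      sum (map (λ y → ∣ ω f y - suc d ∣ * ∣ ω f y - suc d ∣) (image f)) ≤ suc d * (ε ∸ 1) + 1)
theorem2p6 q _ F f d (uniform , _) =
  ceilDivSuc-≤ (q≤I[d+1] A ∑ω² I q d expansion bound) ,
  λ { (suc e) _ _ _ I[d+1]≡q+ε → deviation-bound A ∑ω² I q d expansion bound e I[d+1]≡q+ε }
  where
  I = length (image f)
  A = sum (map (λ y → ∣ ω f y - suc d ∣ * ∣ ω f y - suc d ∣) (image f))
  ∑ω² = ∑[ y < q ] (ω f y * ω f y)

  expansion : A + 2 * (q * suc d) ≡ ∑ω² + I * (suc d * suc d)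
  expansion = sum-image-square-deviation f (suc d)

  bound : ∑ω² + d ≤ q * suc d
  bound = ∑-ω²-bound F f uniform
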